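{- Let $n$, $a$, $q$, $r$ be integers with $n=qa+r$, $r\in\{0,a-1\}$, $a\ge 4$, $q\ge 2$ and $q<a-1$. Then for every $q$-bounded independent broadcast $f$ on $\overrightarrow{C}(n;1,a)$, $$\sigma(f) \le \begin{cases} n-|V_f^2|-q|V_f^1| & \text{if } r=0,\\ n-|V_f^+|-q|V_f^1| & \text{if } r=a-1,\end{cases}$$ where $V_f^+=\{v: f(v)>0\}$, $V_f^1=\{v: f(v)=q\}$ and $V_f^2=\{v: 1\le f(v)\le q-1\}$.
   Context: The oriented circulant graph $\overrightarrow{C}(n;1,a)$ has vertex set $\{v_0,\dots,v_{n-1}\}$ and arcs $v_iv_{i+1}$, $v_iv_{i+a}$, subscripts modulo $n$. $d(u,v)$ is the length of a shortest directed path from $u$ to $v$; $e(v)=\max_u d(v,u)$; $\mathrm{diam}$ is the maximum eccentricity. An independent broadcast is $f:V\to\{0,\dots,\mathrm{diam}\}$ with $f(v)\le e(v)$ for all $v$ and $d(u,v)>f(u)$ for all distinct $u,v$ with $f(u),f(v)>0$; its cost is $\sigma(f)=\sum_v f(v)$. It is $q$-bounded if $f(v)\le q$ for every $v$. -}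

module Defs where

open import Data.Nat using (ℕ; zero; suc; _+_; _*_; _≤_; _<_; _<ᵇ_; NonZero)
open import Data.Nat.DivMod using (_%_)
open import Data.Fin using (Fin; toℕ) renaming (zero to fzero; suc to fsuc)
open import Data.Bool using (if_then_else_)
open import Data.Product using (Σ; _×_; ∃)
open import Data.Sum using (_⊎_)
open import Relation.Binary.PropositionalEquality using (_≡_; _≢_)
open import Relation.Nullary using (¬_)

-- Oriented circulant graph C(n;1,a): vertices Fin n (v_i is i),
-- arcs v_i -> v_{i+1} and v_i -> v_{i+a}, subscripts mod n.
Arc : (n a : ℕ) → .{{_ : NonZero n}} → Fin n → Fin n → Set
Arc n a u v = (toℕ v ≡ (toℕ u + 1) % n) ⊎ (toℕ v ≡ (toℕ u + a) % n)

data Walk (n a : ℕ) .{{_ : NonZero n}} : Fin n → Fin n → ℕ → Set where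
  here : ∀ {u} → Walk n a u u 0
  step : ∀ {u w v k} → Arc n a u w → Walk n a w v k → Walk n a u v (suc k)

IsDist : (n a : ℕ) → .{{_ : NonZero n}} → Fin n → Fin n → ℕ → Set
IsDist n a u v δ = Walk n a u v δ × (∀ k → k < δ → ¬ Walk n a u v k)

EccAtLeast : (n a : ℕ) → .{{_ : NonZero n}} → Fin n → ℕ → Set
EccAtLeast n a v m = Σ (Fin n) λ u → Σ ℕ λ δ → IsDist n a v u δ × m ≤ δ

-- Independent broadcast on C(n;1,a).  (f(v) ≤ diam follows from f(v) ≤ e(v).)
IndependentBroadcast : (n a : ℕ) → .{{_ : NonZero n}} → (Fin n → ℕ) → Set
IndependentBroadcast n a f =
  (∀ v → EccAtLeast n a v (f v)) ×
  (∀ u v → u ≢ v → 0 < f u → 0 < f v → ∀ δ → IsDist n a u v δ → f u < δ)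

QBounded : (n q : ℕ) → (Fin n → ℕ) → Set
QBounded n q f = ∀ v → f v ≤ q

sumFin : ∀ {n} → (Fin n → ℕ) → ℕ
sumFin {zero}  g = 0
sumFin {suc n} g = g fzero + sumFin (λ i → g (fsuc i))

σ : ∀ {n} → (Fin n → ℕ) → ℕ
σ f = sumFin f

cardVplus : ∀ {n} → (Fin n → ℕ) → ℕ
cardVplus f = sumFin (λ v → if 0 <ᵇ f v then 1 else 0)

-- |V_f^1| = #{v : f v = q}
cardV1 : ∀ {n} → ℕ → (Fin n → ℕ) → ℕ
cardV1 q f = sumFin (λ v → if q <ᵇ suc (f v) then (if f v <ᵇ suc q then 1 else 0) else 0)

cardV2 : ∀ {n} → ℕ → (Fin n → ℕ) → ℕ
cardV2 q f = sumFin (λ v → if 0 <ᵇ f v then (if f v <ᵇ q then 1 else 0) else 0)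

{-# OPTIONS --safe #-}
module Submission where

open import Defs
open import Data.Bool using (true; false; if_then_else_)
open import Data.Empty using (⊥-elim)
open import Data.Fin using (Fin; toℕ; splitAt; join; _↑ˡ_; _↑ʳ_) renaming (zero to fzero; suc to fsuc)
open import Data.Fin.Properties
  using (toℕ-injective; toℕ<n; toℕ-fromℕ<; any?; injective⇒≤; join-splitAt; splitAt⁻¹-↑ˡ; splitAt⁻¹-↑ʳ)
  renaming (_≟_ to _≟ᶠ_)
open import Data.Nat using (ℕ; zero; suc; _+_; _*_; _∸_; _≤_; _<_; z≤n; s≤s; NonZero; _<ᵇ_; _≟_; _≤?_; _<?_)
open import Data.Nat.DivMod using (_%_; _mod_; m%n<n; m%n%n≡m%n; %-distribˡ-+; [m+n]%n≡m%n; [m+kn]%n≡m%n; m<n⇒m%n≡m)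
open import Data.Nat.Properties
open import Algebra.Properties.Semiring.Sum +-*-semiring using (sum; ∑-distrib-+; *-distribˡ-sum)
open import Data.Nat.Tactic.RingSolver using (solve-∀)
open import Data.Product using (Σ; ∃; _×_; _,_; proj₁; proj₂; uncurry)
open import Data.Sum using (_⊎_; inj₁; inj₂)
open import Function using (_∘_)
open import Function.Definitions using (Injective)
open import Relation.Binary using (tri<; tri≈; tri>)
open import Relation.Binary.PropositionalEquality
open import Relation.Nullary using (¬_; Dec; yes; no)
open import Relation.Nullary.Decidable using (map′; _×-dec_; _⊎-dec_; dec-true; dec-false)
open import Relation.Unary using (Pred; Decidable)

-- Write n + e = (q + e)·a, so e = 0 when r = 0 and e = 1 when r = a − 1; then (q + e)·a ≡ e (mod n).
-- Every vertex v with f v > 0 claims the f v + 1 vertices v, v + 1, …, v + f v and, when f v = q,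
-- also the q + e − 1 vertices v + (q − j) + j·a with 0 < j < q + e; all of them lie within
-- distance f v of v.  Claims of one vertex are distinct because their offsets s + t·a (s < a)
-- are below n and have distinct base-a digits.  If claims of two broadcasting vertices u ≠ v
-- coincided, comparing the two routes would give a walk from one of u, v to the other of length
-- at most its own broadcast value, either directly or after winding once around the cycle with
-- (q + e)·a ≡ e; independence forbids this.  So all claims are pairwise distinct, and their
-- number, which dominates both left-hand sides vertex by vertex, is at most n.

unflatten : ∀ {m} (c : Fin m → ℕ) → Fin (sumFin c) → Σ (Fin m) (Fin ∘ c)
unflatten {suc m} c i with splitAt (c fzero) i
... | inj₁ k = fzero , k
... | inj₂ j = let v , k = unflatten (c ∘ fsuc) j in fsuc v , k

flatten : ∀ {m} (c : Fin m → ℕ) → Σ (Fin m) (Fin ∘ c) → Fin (sumFin c)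
flatten c (fzero , k)  = k ↑ˡ _
flatten c (fsuc v , k) = c fzero ↑ʳ flatten (c ∘ fsuc) (v , k)

flatten-unflatten : ∀ {m} (c : Fin m → ℕ) i → flatten c (unflatten c i) ≡ i
flatten-unflatten {suc m} c i with splitAt (c fzero) i in eq
... | inj₁ k = splitAt⁻¹-↑ˡ eq
... | inj₂ j = trans (cong (c fzero ↑ʳ_) (flatten-unflatten (c ∘ fsuc) j)) (splitAt⁻¹-↑ʳ eq)

injective⇒sumFin≤ : ∀ {m n} {c : Fin m → ℕ} {φ : Σ (Fin m) (Fin ∘ c) → Fin n} →
                    Injective _≡_ _≡_ φ → sumFin c ≤ n
injective⇒sumFin≤ {c = c} φ-injective = injective⇒≤ λ {i} {j} φi≡φj → begin
  i                          ≡⟨ flatten-unflatten c i ⟨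
  flatten c (unflatten c i)  ≡⟨ cong (flatten c) (φ-injective {unflatten c i} {unflatten c j} φi≡φj) ⟩
  flatten c (unflatten c j)  ≡⟨ flatten-unflatten c j ⟩
  j                          ∎
  where open ≡-Reasoning

sumFin≡sum : ∀ {m} (g : Fin m → ℕ) → sumFin g ≡ sum g
sumFin≡sum {zero}  g = refl
sumFin≡sum {suc m} g = cong (g fzero +_) (sumFin≡sum (g ∘ fsuc))

sumFin-distrib-+ : ∀ {m} (g h : Fin m → ℕ) → sumFin (λ v → g v + h v) ≡ sumFin g + sumFin h
sumFin-distrib-+ g h = begin
  sumFin (λ v → g v + h v)  ≡⟨ sumFin≡sum (λ v → g v + h v) ⟩
  sum (λ v → g v + h v)     ≡⟨ ∑-distrib-+ g h ⟩
  sum g + sum h             ≡⟨ cong₂ _+_ (sumFin≡sum g) (sumFin≡sum h) ⟨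
  sumFin g + sumFin h       ∎
  where open ≡-Reasoning

*-distribˡ-sumFin : ∀ {m} x (g : Fin m → ℕ) → x * sumFin g ≡ sumFin (λ v → x * g v)
*-distribˡ-sumFin x g = begin
  x * sumFin g            ≡⟨ cong (x *_) (sumFin≡sum g) ⟩
  x * sum g               ≡⟨ *-distribˡ-sum x g ⟩
  sum (λ v → x * g v)     ≡⟨ sumFin≡sum (λ v → x * g v) ⟨
  sumFin (λ v → x * g v)  ∎
  where open ≡-Reasoning

sumFin-mono-≤ : ∀ {m} {g h : Fin m → ℕ} → (∀ v → g v ≤ h v) → sumFin g ≤ sumFin h
sumFin-mono-≤ {zero}  g≤h = z≤n
sumFin-mono-≤ {suc m} g≤h = +-mono-≤ (g≤h fzero) (sumFin-mono-≤ (g≤h ∘ fsuc))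

module _ {p} {P : Pred ℕ p} (P? : Decidable P) where

  least-witness : ∀ k → (∃ λ j → j ≤ k × P j) → ∃ λ δ → P δ × (∀ {j} → j < δ → ¬ P j)
  least-witness k (j , j≤k , Pj) with anyUpTo? P? k
  ... | no  none                = j , Pj , λ i<j Pi → none (_ , <-≤-trans i<j j≤k , Pi)
  ... | yes (i , s≤s i≤k′ , Pi) = least-witness _ (i , i≤k′ , Pi)

divMod-unique : ∀ {a s t s′ t′} → s < a → s′ < a → s + t * a ≡ s′ + t′ * a → s ≡ s′ × t ≡ t′
divMod-unique {suc a} {s} {t} {s′} {t′} s<a s′<a eq =
  s≡s′ , *-cancelʳ-≡ t t′ (suc a) (+-cancelˡ-≡ s _ _ (trans eq (cong (_+ t′ * suc a) (sym s≡s′))))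
  where
  s≡s′ : s ≡ s′
  s≡s′ = begin
    s                          ≡⟨ m<n⇒m%n≡m s<a ⟨
    s % suc a                  ≡⟨ [m+kn]%n≡m%n s t (suc a) ⟨
    (s + t * suc a) % suc a    ≡⟨ cong (_% suc a) eq ⟩
    (s′ + t′ * suc a) % suc a  ≡⟨ [m+kn]%n≡m%n s′ t′ (suc a) ⟩
    s′ % suc a                 ≡⟨ m<n⇒m%n≡m s′<a ⟩
    s′                         ∎
    where open ≡-Reasoning

module Circulant (n a : ℕ) .{{_ : NonZero n}} where

  infix 4 _≋_
  _≋_ : ℕ → ℕ → Set
  x ≋ y = x % n ≡ y % n

  m%n≋m : ∀ x → x % n ≋ x
  m%n≋m x = m%n%n≡m%n x n

  +-congʳ-≋ : ∀ {x y} z → x ≋ y → x + z ≋ y + z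
  +-congʳ-≋ {x} {y} z x≋y = begin
    (x + z) % n          ≡⟨ %-distribˡ-+ x z n ⟩
    (x % n + z % n) % n  ≡⟨ cong (λ w → (w + z % n) % n) x≋y ⟩
    (y % n + z % n) % n  ≡⟨ %-distribˡ-+ y z n ⟨
    (y + z) % n          ∎
    where open ≡-Reasoning

  +-cancelʳ-≋ : ∀ {x y} z → x + z ≋ y + z → x ≋ y
  +-cancelʳ-≋ {x} {y} z x+z≋y+z = begin
    x % n                      ≡⟨ [m+kn]%n≡m%n x z n ⟨
    (x + z * n) % n            ≡⟨ cong (_% n) (shift x) ⟩
    (x + z + (z * n ∸ z)) % n  ≡⟨ +-congʳ-≋ (z * n ∸ z) x+z≋y+z ⟩
    (y + z + (z * n ∸ z)) % n  ≡⟨ cong (_% n) (shift y) ⟨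
    (y + z * n) % n            ≡⟨ [m+kn]%n≡m%n y z n ⟩
    y % n                      ∎
    where
    open ≡-Reasoning
    shift : ∀ w → w + z * n ≡ w + z + (z * n ∸ z)
    shift w = trans (cong (w +_) (sym (m+[n∸m]≡n (m≤m*n z n)))) (sym (+-assoc w z _))

  +-cancelˡ-≋ : ∀ {x y} z → z + x ≋ z + y → x ≋ y
  +-cancelˡ-≋ {x} {y} z z+x≋z+y = +-cancelʳ-≋ z (subst₂ _≋_ (+-comm z x) (+-comm z y) z+x≋z+y)

  ≋⇒≡ : ∀ {x y} → x < n → y < n → x ≋ y → x ≡ y
  ≋⇒≡ x<n y<n x≋y = trans (sym (m<n⇒m%n≡m x<n)) (trans x≋y (m<n⇒m%n≡m y<n))

  mod-injective : ∀ {x y} → x mod n ≡ y mod n → x ≋ y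
  mod-injective {x} {y} eq =
    trans (sym (toℕ-fromℕ< (m%n<n x n))) (trans (cong toℕ eq) (toℕ-fromℕ< (m%n<n y n)))

  arc-≋ : ∀ d r {u v : Fin n} → toℕ u + (d + r) ≋ toℕ v → toℕ ((toℕ u + d) mod n) + r ≋ toℕ v
  arc-≋ d r {u} {v} eq = begin
    (toℕ ((toℕ u + d) mod n) + r) % n
      ≡⟨ cong (λ w → (w + r) % n) (toℕ-fromℕ< (m%n<n (toℕ u + d) n)) ⟩
    ((toℕ u + d) % n + r) % n  ≡⟨ +-congʳ-≋ r (m%n≋m (toℕ u + d)) ⟩
    (toℕ u + d + r) % n        ≡⟨ cong (_% n) (+-assoc (toℕ u) d r) ⟩
    (toℕ u + (d + r)) % n      ≡⟨ eq ⟩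
    toℕ v % n                  ∎
    where open ≡-Reasoning

  walk : ∀ s t {u v : Fin n} → toℕ u + (s + t * a) ≋ toℕ v → Walk n a u v (s + t)
  walk zero zero {u} {v} eq = subst (λ w → Walk n a u w 0) u≡v here
    where
    u≡v = toℕ-injective (≋⇒≡ (toℕ<n u) (toℕ<n v) (trans (cong (_% n) (sym (+-identityʳ (toℕ u)))) eq))
  walk (suc s) t    eq = step (inj₁ (toℕ-fromℕ< _)) (walk s t (arc-≋ 1 (s + t * a) eq))
  walk zero (suc t) eq = step (inj₂ (toℕ-fromℕ< _)) (walk zero t (arc-≋ a (t * a) eq))

  arc? : ∀ u w → Dec (Arc n a u w)
  arc? u w = (toℕ w ≟ (toℕ u + 1) % n) ⊎-dec (toℕ w ≟ (toℕ u + a) % n)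

  walk? : ∀ k u v → Dec (Walk n a u v k)
  walk? zero    u v = map′ (λ { refl → here }) (λ { here → refl }) (u ≟ᶠ v)
  walk? (suc k) u v = map′ (λ (w , uw , wv) → step uw wv) (λ { (step uw wv) → _ , uw , wv })
                           (any? λ w → arc? u w ×-dec walk? k w v)

  distance≤walk : ∀ {u v k} → Walk n a u v k → ∃ λ δ → IsDist n a u v δ × δ ≤ k
  distance≤walk {u} {v} {k} w with least-witness (λ j → walk? j u v) k (k , ≤-refl , w)
  ... | δ , wδ , minimal = δ , (wδ , λ j j<δ → minimal j<δ) , ≮⇒≥ λ k<δ → minimal k<δ w

  Independent : (Fin n → ℕ) → Set
  Independent f = ∀ u v → u ≢ v → 0 < f u → 0 < f v → ∀ δ → IsDist n a u v δ → f u < δ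

  independent⇒<walk : ∀ {f} → Independent f → ∀ {u v k} → u ≢ v → 0 < f u → 0 < f v →
                      Walk n a u v k → f u < k
  independent⇒<walk independent u≢v 0<fu 0<fv w with distance≤walk w
  ... | δ , dist , δ≤k = <-≤-trans (independent _ _ u≢v 0<fu 0<fv δ dist) δ≤k

<ᵇ-true : ∀ {m n} → m < n → (m <ᵇ n) ≡ true
<ᵇ-true = dec-true (_ <? _)

<ᵇ-false : ∀ {m n} → n ≤ m → (m <ᵇ n) ≡ false
<ᵇ-false n≤m = dec-false (_ <? _) (≤⇒≯ n≤m)

𝟙⁺ : ℕ → ℕ
𝟙⁺ x = if 0 <ᵇ x then 1 else 0

𝟙¹ : ℕ → ℕ → ℕ
𝟙¹ q x = if q <ᵇ suc x then (if x <ᵇ suc q then 1 else 0) else 0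

𝟙² : ℕ → ℕ → ℕ
𝟙² q x = if 0 <ᵇ x then (if x <ᵇ q then 1 else 0) else 0

𝟙⁺-pos : ∀ {x} → 0 < x → 𝟙⁺ x ≡ 1
𝟙⁺-pos {suc x} _ = refl

𝟙¹-below : ∀ {q x} → x < q → 𝟙¹ q x ≡ 0
𝟙¹-below x<q rewrite <ᵇ-false x<q = refl

𝟙¹-diag : ∀ q → 𝟙¹ q q ≡ 1
𝟙¹-diag q rewrite <ᵇ-true (n<1+n q) = refl

𝟙²-below : ∀ {q x} → x < q → 𝟙² q x ≡ 𝟙⁺ x
𝟙²-below {x = zero}  _   = refl
𝟙²-below {x = suc x} x<q rewrite <ᵇ-true x<q = refl

𝟙²-diag : ∀ q → 𝟙² q q ≡ 0
𝟙²-diag zero    = refl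
𝟙²-diag (suc q) rewrite <ᵇ-false (≤-refl {q}) = refl

module Claims (n a q e : ℕ) .{{_ : NonZero n}} (n+e≡[q+e]a : n + e ≡ (q + e) * a)
              (e≤1 : e ≤ 1) (q+e<a : q + e < a) (1≤q : 1 ≤ q) where

  open Circulant n a

  -- (s , t) stands for the vertex v + s + t·a, reached from v by s arcs of length 1 and t of length a.
  record IsClaim (x s t : ℕ) : Set where
    field
      broadcasting : 0 < x
      within       : s + t ≤ x
      ones+e<a     : s + e < a
      jumps<q+e    : t < q + e
      jumps⇒full   : 0 < t → s + t ≡ q

  open IsClaim

  offset : ℕ × ℕ → ℕ
  offset (s , t) = s + t * a

  wrap : ∀ y → y + (q + e) * a ≋ y + e
  wrap y = begin
    (y + (q + e) * a) % n  ≡⟨ cong (λ w → (y + w) % n) n+e≡[q+e]a ⟨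
    (y + (n + e)) % n      ≡⟨ cong (_% n) (shuffle y n e) ⟩
    (y + e + n) % n        ≡⟨ [m+n]%n≡m%n (y + e) n ⟩
    (y + e) % n            ∎
    where
    open ≡-Reasoning
    shuffle : ∀ y n e → y + (n + e) ≡ y + e + n
    shuffle = solve-∀

  ones<a : ∀ {x s t} → IsClaim x s t → s < a
  ones<a c = ≤-<-trans (m≤m+n _ e) (ones+e<a c)

  claim<n : ∀ {x s t} → IsClaim x s t → s + t * a < n
  claim<n {s = s} {t} c = +-cancelʳ-< e (s + t * a) n (begin-strict
    s + t * a + e  ≡⟨ shuffle s (t * a) e ⟩
    s + e + t * a  <⟨ +-monoˡ-< (t * a) (ones+e<a c) ⟩
    suc t * a      ≤⟨ *-monoˡ-≤ a (jumps<q+e c) ⟩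
    (q + e) * a    ≡⟨ n+e≡[q+e]a ⟨
    n + e          ∎)
    where
    open ≤-Reasoning
    shuffle : ∀ s u e → s + u + e ≡ s + e + u
    shuffle = solve-∀

  offset-injective : ∀ {x y p p′} → uncurry (IsClaim x) p → uncurry (IsClaim y) p′ →
                     offset p ≋ offset p′ → p ≡ p′
  offset-injective {p = s , t} {s′ , t′} c c′ eq
    with divMod-unique {t = t} {t′ = t′} (ones<a c) (ones<a c′) (≋⇒≡ (claim<n c) (claim<n c′) eq)
  ... | refl , refl = refl

  module Disjoint (f : Fin n → ℕ) (independent : Independent f) where

    no-short-jump : ∀ {u v s t} → u ≢ v → 0 < f u → 0 < f v → s + t ≤ f u →
                    ¬ (toℕ u + (s + t * a) ≋ toℕ v)
    no-short-jump {s = s} {t} u≢v 0<fu 0<fv s+t≤fu eq =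
      <⇒≱ (independent⇒<walk independent u≢v 0<fu 0<fv (walk s t eq)) s+t≤fu

    direct-collision : ∀ {u v s t s′ t′} → u ≢ v → IsClaim (f u) s t → IsClaim (f v) s′ t′ →
                       s′ ≤ s → t′ ≤ t → ¬ (toℕ u + (s + t * a) ≋ toℕ v + (s′ + t′ * a))
    direct-collision {u} {s′ = s′} {t′} u≢v c c′ s′≤s t′≤t eq
      with ds , refl ← m≤n⇒∃[o]m+o≡n s′≤s | dt , refl ← m≤n⇒∃[o]m+o≡n t′≤t =
      no-short-jump {s = ds} {dt} u≢v (broadcasting c) (broadcasting c′)
        (≤-trans (+-mono-≤ (m≤n+m ds s′) (m≤n+m dt t′)) (within c))
        (+-cancelʳ-≋ (s′ + t′ * a) (trans (cong (_% n) (shuffle (toℕ u) s′ ds t′ dt a)) eq))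
      where
      shuffle : ∀ x s′ ds t′ dt a →
                x + (ds + dt * a) + (s′ + t′ * a) ≡ x + (s′ + ds + (t′ + dt) * a)
      shuffle = solve-∀

    -- Adding (s′ + t + e)·a to both sides turns the right-hand side into
    -- v + s′ + t·a + (q + e)·a ≡ v + s′ + t·a + e, leaving a walk of length s + t from u to v.
    wrapped-collision : ∀ {u v s t s′ t′} → u ≢ v → IsClaim (f u) s t → IsClaim (f v) s′ t′ →
                        s′ + e ≤ s → 0 < t′ → ¬ (toℕ u + (s + t * a) ≋ toℕ v + (s′ + t′ * a))
    wrapped-collision {u} {v} {t = t} {s′} {t′} u≢v c c′ s′+e≤s 0<t′ eq
      with d , refl ← m≤n⇒∃[o]m+o≡n s′+e≤s =
      no-short-jump {s = d} {k} u≢v (broadcasting c) (broadcasting c′)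
        (≤-trans (≤-reflexive (length d s′ t e)) (within c))
        (+-cancelʳ-≋ (s′ + t * a + e) around)
      where
      open ≡-Reasoning
      k = s′ + t + e
      around : toℕ u + (d + k * a) + (s′ + t * a + e) ≋ toℕ v + (s′ + t * a + e)
      around = begin
        (toℕ u + (d + k * a) + (s′ + t * a + e)) % n    ≡⟨ cong (_% n) (shuffle₁ (toℕ u) d s′ t e a) ⟩
        (toℕ u + (s′ + e + d + t * a) + k * a) % n      ≡⟨ +-congʳ-≋ (k * a) eq ⟩
        (toℕ v + (s′ + t′ * a) + k * a) % n             ≡⟨ cong (_% n) (shuffle₂ (toℕ v) s′ t t′ e a) ⟩
        (toℕ v + (s′ + t * a) + (s′ + t′ + e) * a) % n
          ≡⟨ cong (λ w → (toℕ v + (s′ + t * a) + (w + e) * a) % n) (jumps⇒full c′ 0<t′) ⟩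
        (toℕ v + (s′ + t * a) + (q + e) * a) % n        ≡⟨ wrap (toℕ v + (s′ + t * a)) ⟩
        (toℕ v + (s′ + t * a) + e) % n                  ≡⟨ cong (_% n) (+-assoc (toℕ v) (s′ + t * a) e) ⟩
        (toℕ v + (s′ + t * a + e)) % n                  ∎
        where
        shuffle₁ : ∀ x d s′ t e a → x + (d + (s′ + t + e) * a) + (s′ + t * a + e) ≡
                                    x + (s′ + e + d + t * a) + (s′ + t + e) * a
        shuffle₁ = solve-∀
        shuffle₂ : ∀ x s′ t t′ e a → x + (s′ + t′ * a) + (s′ + t + e) * a ≡
                                     x + (s′ + t * a) + (s′ + t′ + e) * a
        shuffle₂ = solve-∀
      length : ∀ d s′ t e → d + (s′ + t + e) ≡ s′ + e + d + t
      length = solve-∀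

    collision-with-fewer-ones : ∀ {u v s t s′ t′} → u ≢ v → IsClaim (f u) s t → IsClaim (f v) s′ t′ →
                                s′ < s → ¬ (toℕ u + (s + t * a) ≋ toℕ v + (s′ + t′ * a))
    collision-with-fewer-ones {s = s} {t} {s′} {t′} u≢v c c′ s′<s with t′ ≤? t
    ... | yes t′≤t = direct-collision u≢v c c′ (<⇒≤ s′<s) t′≤t
    ... | no  t′≰t = wrapped-collision u≢v c c′ s′+e≤s (≤-<-trans z≤n (≰⇒> t′≰t))
      where
      s′+e≤s : s′ + e ≤ s
      s′+e≤s = ≤-trans (+-monoʳ-≤ s′ e≤1) (subst (_≤ s) (+-comm 1 s′) s′<s)

    claims-disjoint : ∀ {u v s t s′ t′} → u ≢ v → IsClaim (f u) s t → IsClaim (f v) s′ t′ →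
                      ¬ (toℕ u + (s + t * a) ≋ toℕ v + (s′ + t′ * a))
    claims-disjoint {s = s} {t} {s′} {t′} u≢v c c′ with <-cmp s′ s
    ... | tri< s′<s _ _ = collision-with-fewer-ones u≢v c c′ s′<s
    ... | tri> _ _ s<s′ = collision-with-fewer-ones (≢-sym u≢v) c′ c s<s′ ∘ sym
    ... | tri≈ _ refl _ with ≤-total t′ t
    ...   | inj₁ t′≤t = direct-collision u≢v c c′ ≤-refl t′≤t
    ...   | inj₂ t≤t′ = direct-collision (≢-sym u≢v) c′ c ≤-refl t≤t′ ∘ sym

  farCount : ∀ {x} → Dec (x ≡ q) → ℕ
  farCount (yes _) = q + e ∸ 1
  farCount (no _)  = 0

  claimCount : ℕ → ℕ
  claimCount x = x + 𝟙⁺ x + farCount (x ≟ q)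

  route : ∀ {m m′} → Fin m ⊎ Fin m′ → ℕ × ℕ
  route (inj₁ k) = toℕ k , 0
  route (inj₂ j) = q ∸ suc (toℕ j) , suc (toℕ j)

  route-injective : ∀ {m m′} → Injective _≡_ _≡_ (route {m} {m′})
  route-injective {x = inj₁ k} {inj₁ k′} eq = cong inj₁ (toℕ-injective (cong proj₁ eq))
  route-injective {x = inj₂ j} {inj₂ j′} eq = cong inj₂ (toℕ-injective (suc-injective (cong proj₂ eq)))
  route-injective {x = inj₁ _} {inj₂ _}  eq = ⊥-elim (0≢1+n (cong proj₂ eq))
  route-injective {x = inj₂ _} {inj₁ _}  eq = ⊥-elim (0≢1+n (sym (cong proj₂ eq)))

  claim : ∀ x → Fin (claimCount x) → ℕ × ℕ
  claim x = route ∘ splitAt (x + 𝟙⁺ x)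

  claim-injective : ∀ x → Injective _≡_ _≡_ (claim x)
  claim-injective x {i} {j} eq = begin
    i                                ≡⟨ join-splitAt (x + 𝟙⁺ x) _ i ⟨
    join _ _ (splitAt (x + 𝟙⁺ x) i)  ≡⟨ cong (join _ _) (route-injective eq) ⟩
    join _ _ (splitAt (x + 𝟙⁺ x) j)  ≡⟨ join-splitAt (x + 𝟙⁺ x) _ j ⟩
    j                                ∎
    where open ≡-Reasoning

  near-isClaim : ∀ {x} → x ≤ q → (k : Fin (x + 𝟙⁺ x)) → IsClaim x (toℕ k) 0
  near-isClaim {suc y} x≤q k = record
    { broadcasting = s≤s z≤n
    ; within       = k≤x
    ; ones+e<a     = ≤-<-trans (+-monoˡ-≤ e (≤-trans (m+n≤o⇒m≤o _ k≤x) x≤q)) q+e<a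
    ; jumps<q+e    = ≤-trans 1≤q (m≤m+n q e)
    ; jumps⇒full   = λ ()
    }
    where
    k≤x : toℕ k + 0 ≤ suc y
    k≤x = subst (_≤ suc y) (sym (+-identityʳ (toℕ k)))
                (m<1+n⇒m≤n (subst (toℕ k <_) (+-comm (suc y) 1) (toℕ<n k)))

  far-isClaim : ∀ {x} (x≟q : Dec (x ≡ q)) (j : Fin (farCount x≟q)) →
                IsClaim x (q ∸ suc (toℕ j)) (suc (toℕ j))
  far-isClaim (yes refl) j = record
    { broadcasting = 1≤q
    ; within       = ≤-reflexive (m∸n+n≡m t≤q)
    ; ones+e<a     = ≤-<-trans (≤-trans (+-monoʳ-≤ (q ∸ t) e≤t) (≤-reflexive (m∸n+n≡m t≤q)))
                               (≤-<-trans (m≤m+n q e) q+e<a)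
    ; jumps<q+e    = subst (_≤ q + e) (+-comm t 1) t+1≤q+e
    ; jumps⇒full   = λ _ → m∸n+n≡m t≤q
    }
    where
    t = suc (toℕ j)
    t+1≤q+e : t + 1 ≤ q + e
    t+1≤q+e = m≤o∸n⇒m+n≤o t (≤-trans 1≤q (m≤m+n q e)) (toℕ<n j)
    t≤q : t ≤ q
    t≤q = +-cancelʳ-≤ 1 t q (≤-trans t+1≤q+e (+-monoʳ-≤ q e≤1))
    e≤t : e ≤ t
    e≤t = ≤-trans e≤1 (s≤s z≤n)

  route-isClaim : ∀ {x} → x ≤ q → (c : Fin (x + 𝟙⁺ x) ⊎ Fin (farCount (x ≟ q))) →
                  uncurry (IsClaim x) (route c)
  route-isClaim x≤q   (inj₁ k) = near-isClaim x≤q k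
  route-isClaim {x} _ (inj₂ j) = far-isClaim (x ≟ q) j

  claim-isClaim : ∀ {x} → x ≤ q → (i : Fin (claimCount x)) → uncurry (IsClaim x) (claim x i)
  claim-isClaim {x} x≤q i = route-isClaim x≤q (splitAt (x + 𝟙⁺ x) i)

  packing : (f : Fin n → ℕ) → Independent f → (∀ v → f v ≤ q) → sumFin (claimCount ∘ f) ≤ n
  packing f independent bounded = injective⇒sumFin≤ claimed-injective
    where
    open Disjoint f independent
    claimed : Σ (Fin n) (Fin ∘ claimCount ∘ f) → Fin n
    claimed (v , i) = (toℕ v + offset (claim (f v) i)) mod n
    claimed-injective : Injective _≡_ _≡_ claimed
    claimed-injective {v , i} {w , j} eq with v ≟ᶠ w
    ... | no v≢w   = ⊥-elim (claims-disjoint v≢w (claim-isClaim (bounded v) i) (claim-isClaim (bounded w) j)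
                                             (mod-injective eq))
    ... | yes refl = cong (v ,_) (claim-injective (f v)
                       (offset-injective (claim-isClaim (bounded v) i) (claim-isClaim (bounded v) j)
                         (+-cancelˡ-≋ (toℕ v) (mod-injective eq))))

  cost≤claimCount : (g : ℕ → ℕ) → (∀ {x} → x < q → g x ≤ 𝟙⁺ x) → g q + q ≤ 1 + (q + e ∸ 1) →
                    ∀ {x} → x ≤ q → x + g x + q * 𝟙¹ q x ≤ claimCount x
  cost≤claimCount g g-below g-top {x} x≤q with m≤n⇒m<n∨m≡n x≤q
  ... | inj₁ x<q rewrite 𝟙¹-below x<q | *-zeroʳ q | +-identityʳ (x + g x) =
    ≤-trans (+-monoʳ-≤ x (g-below x<q)) (m≤m+n (x + 𝟙⁺ x) _)
  ... | inj₂ refl rewrite 𝟙¹-diag q | ≟-diag (refl {x = q}) | 𝟙⁺-pos 1≤q = begin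
    q + g q + q * 1        ≡⟨ cong (q + g q +_) (*-identityʳ q) ⟩
    q + g q + q            ≡⟨ +-assoc q (g q) q ⟩
    q + (g q + q)          ≤⟨ +-monoʳ-≤ q g-top ⟩
    q + (1 + (q + e ∸ 1))  ≡⟨ +-assoc q 1 _ ⟨
    q + 1 + (q + e ∸ 1)    ∎
    where open ≤-Reasoning

  cost-bound : (f : Fin n → ℕ) → Independent f → (∀ v → f v ≤ q) →
               (g : ℕ → ℕ) → (∀ {x} → x < q → g x ≤ 𝟙⁺ x) → g q + q ≤ 1 + (q + e ∸ 1) →
               σ f + sumFin (g ∘ f) + q * sumFin (𝟙¹ q ∘ f) ≤ n
  cost-bound f independent bounded g g-below g-top = begin
    σ f + sumFin (g ∘ f) + q * sumFin (𝟙¹ q ∘ f)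
      ≡⟨ cong₂ _+_ (sym (sumFin-distrib-+ f (g ∘ f))) (*-distribˡ-sumFin q (𝟙¹ q ∘ f)) ⟩
    sumFin (λ v → f v + g (f v)) + sumFin (λ v → q * 𝟙¹ q (f v))
      ≡⟨ sumFin-distrib-+ (λ v → f v + g (f v)) (λ v → q * 𝟙¹ q (f v)) ⟨
    sumFin (λ v → f v + g (f v) + q * 𝟙¹ q (f v))
      ≤⟨ sumFin-mono-≤ (λ v → cost≤claimCount g g-below g-top (bounded v)) ⟩
    sumFin (claimCount ∘ f)
      ≤⟨ packing f independent bounded ⟩
    n ∎
    where open ≤-Reasoning

qa+[a∸1]+1≡[q+1]a : ∀ q {a} → 1 ≤ a → q * a + (a ∸ 1) + 1 ≡ (q + 1) * a
qa+[a∸1]+1≡[q+1]a q {a} 1≤a = begin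
  q * a + (a ∸ 1) + 1  ≡⟨ +-assoc (q * a) (a ∸ 1) 1 ⟩
  q * a + (a ∸ 1 + 1)  ≡⟨ cong (q * a +_) (m∸n+n≡m 1≤a) ⟩
  q * a + a            ≡⟨ distrib q a ⟩
  (q + 1) * a          ∎
  where
  open ≡-Reasoning
  distrib : ∀ q a → q * a + a ≡ (q + 1) * a
  distrib = solve-∀

proposition21 : (n a q r : ℕ) → .{{_ : NonZero n}} →
    n ≡ q * a + r → 4 ≤ a → 2 ≤ q → q < a ∸ 1 →
    (f : Fin n → ℕ) → IndependentBroadcast n a f → QBounded n q f →
    (r ≡ 0 → σ f + cardV2 q f + q * cardV1 q f ≤ n) ×
    (r ≡ a ∸ 1 → σ f + cardVplus f + q * cardV1 q f ≤ n)
proposition21 n a q r n≡qa+r 4≤a 2≤q q<a∸1 f (_ , independent) bounded = bound₀ , bound₁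
  where
  1≤a = ≤-trans (s≤s z≤n) 4≤a
  1≤q = ≤-trans (s≤s z≤n) 2≤q
  q+1<a : q + 1 < a
  q+1<a = m≤o∸n⇒m+n≤o (suc q) 1≤a q<a∸1

  bound₀ : r ≡ 0 → σ f + cardV2 q f + q * cardV1 q f ≤ n
  bound₀ refl = Claims.cost-bound n a q 0 n+0≡[q+0]a z≤n (≤-<-trans (+-monoʳ-≤ q z≤n) q+1<a) 1≤q
                  f independent bounded (𝟙² q) (≤-reflexive ∘ 𝟙²-below) top
    where
    n+0≡[q+0]a : n + 0 ≡ (q + 0) * a
    n+0≡[q+0]a rewrite +-identityʳ n | +-identityʳ q = trans n≡qa+r (+-identityʳ (q * a))
    top : 𝟙² q q + q ≤ 1 + (q + 0 ∸ 1)
    top rewrite 𝟙²-diag q | +-identityʳ q = m≤n+m∸n q 1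

  bound₁ : r ≡ a ∸ 1 → σ f + cardVplus f + q * cardV1 q f ≤ n
  bound₁ refl = Claims.cost-bound n a q 1 (trans (cong (_+ 1) n≡qa+r) (qa+[a∸1]+1≡[q+1]a q 1≤a))
                  ≤-refl q+1<a 1≤q f independent bounded 𝟙⁺ (λ _ → ≤-refl) top
    where
    top : 𝟙⁺ q + q ≤ 1 + (q + 1 ∸ 1)
    top rewrite 𝟙⁺-pos 1≤q | m+n∸n≡m q 1 = ≤-refl
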